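{- Let $\mathbb{F}$ be a field with $\operatorname{char}(\mathbb{F})\neq 2$, $M\in\mathbb{F}^2$, $r\in\mathbb{F}^{*}$, and let $q$ be a perfect distance with respect to $C(M,r)_{\mathbb{F}}$. Then $q\in\square_{\boldsymbol{P}(\mathbb{F})}$ and $1-\frac{q}{4r^2}\in\square_{\boldsymbol{P}(\mathbb{F})}$.
   Context: $\boldsymbol{P}(\mathbb{F})$ is the prime subfield of $\mathbb{F}$, $\square_K=\{a^2:a\in K\}$. $C(M,r)_{\mathbb{F}}=\{(x,y)\in\mathbb{F}^2:(x-m_1)^2+(y-m_2)^2=r^2\}$ for $M=(m_1,m_2)$, $r\neq0$. $D^2(P,Q)=(p_1-q_1)^2+(p_2-q_2)^2$; $P,Q$ have rational squared distance if $D^2(P,Q)\in\square_{\boldsymbol{P}(\mathbb{F})}$. An element $q\in\mathbb{F}$ is a perfect distance with respect to $C(M,r)_{\mathbb{F}}$ if $q=D^2(A,B)$ for two points $A,B\in C(M,r)_{\mathbb{F}}$ with rational squared distance and there is a third point $X\in C(M,r)_{\mathbb{F}}$, with $A,B,X$ pairwise different, such that all squared distances among $A,B,X$ are rational. -}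

module Defs where

open import Level using (Level; _⊔_; suc)
open import Algebra.Bundles using (CommutativeRing)
open import Relation.Nullary using (¬_)
open import Data.Product using (Σ; _×_; _,_; ∃)

-- A field: a commutative ring with 1 ≠ 0 and a (total) inverse operation
-- that is a multiplicative inverse on every nonzero element.
-- (The value of 0⁻¹ is unconstrained; it is never used.)
record Field (c ℓ : Level) : Set (suc (c ⊔ ℓ)) where
  field
    commRing : CommutativeRing c ℓ
  open CommutativeRing commRing public
  field
    _⁻¹      : Carrier → Carrier
    ⁻¹-cong  : ∀ {x y} → x ≈ y → (x ⁻¹) ≈ (y ⁻¹)
    1≉0      : ¬ (1# ≈ 0#)
    inverseʳ : ∀ x → ¬ (x ≈ 0#) → (x * (x ⁻¹)) ≈ 1#

module FieldNotions {c ℓ : Level} (F : Field c ℓ) where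
  open Field F

  _/_ : Carrier → Carrier → Carrier
  x / y = x * (y ⁻¹)

  2# : Carrier
  2# = 1# + 1#

  4# : Carrier
  4# = 2# + 2#

  sq : Carrier → Carrier
  sq x = x * x

  CharNot2 : Set ℓ
  CharNot2 = ¬ (2# ≈ 0#)

  record IsSubfield (S : Carrier → Set (c ⊔ ℓ)) : Set (c ⊔ ℓ) where
    field
      resp   : ∀ {x y} → x ≈ y → S x → S y
      has0   : S 0#
      has1   : S 1#
      +-clos : ∀ {x y} → S x → S y → S (x + y)
      neg-clos : ∀ {x} → S x → S (- x)
      *-clos : ∀ {x y} → S x → S y → S (x * y)
      ⁻¹-clos : ∀ {x} → S x → ¬ (x ≈ 0#) → S (x ⁻¹)

  -- the prime subfield P(F): the intersection of all subfields of F
  InPrime : Carrier → Set (suc (c ⊔ ℓ))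
  InPrime x = (S : Carrier → Set (c ⊔ ℓ)) → IsSubfield S → S x

  SquareInPrime : Carrier → Set (suc (c ⊔ ℓ))
  SquareInPrime x = Σ Carrier λ a → InPrime a × (x ≈ sq a)

  Point : Set c
  Point = Carrier × Carrier

  _≈ₚ_ : Point → Point → Set ℓ
  (a₁ , a₂) ≈ₚ (b₁ , b₂) = (a₁ ≈ b₁) × (a₂ ≈ b₂)

  D² : Point → Point → Carrier
  D² (p₁ , p₂) (q₁ , q₂) = sq (p₁ - q₁) + sq (p₂ - q₂)

  RationalSqDist : Point → Point → Set (suc (c ⊔ ℓ))
  RationalSqDist P Q = SquareInPrime (D² P Q)

  OnCircle : Point → Carrier → Point → Set ℓ
  OnCircle (m₁ , m₂) r (x , y) = (sq (x - m₁) + sq (y - m₂)) ≈ sq r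

  PerfectDistance : Point → Carrier → Carrier → Set (suc (c ⊔ ℓ))
  PerfectDistance M r q =
    Σ Point λ A → Σ Point λ B → Σ Point λ X →
      OnCircle M r A × OnCircle M r B × OnCircle M r X ×
      ¬ (A ≈ₚ B) × ¬ (A ≈ₚ X) × ¬ (B ≈ₚ X) ×
      RationalSqDist A B × RationalSqDist A X × RationalSqDist B X ×
      (q ≈ D² A B)

-- Put the origin at the third point X and let w = M - X. For p = A - X and s = B - X, lying on
-- the circle means 2⟨p,w⟩ = |p|² and 2⟨s,w⟩ = |s|², and polarization gives
-- 2⟨p,s⟩ = |p|² + |s|² - |A - B|². As the Gram determinant of three plane vectors vanishes,
-- r² = |w|² is then determined by the squared sides b² = |p|², a² = |s|², c² = |A - B|²:
-- r² (4a²b² - N²) = a²b²c² with N = a² + b² - c², the extended law of sines c = 2r sin γ for the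
-- angle γ at X. Hence 1 - c²/(4r²) = (N / 2ab)² = cos² γ, and N / 2ab lies in the prime field
-- together with a, b, c. It is defined because a point of the circle at squared distance 0 from X
-- would give an isotropic p orthogonal to the anisotropic w, which forces p = 0.
module Submission where

open import Defs
open import Level using (Level)
open import Relation.Nullary using (¬_; yes; no)
open import Data.Product using (_×_; _,_; proj₁; proj₂)
open import Data.Nat as ℕ using (ℕ)
import Data.Nat.Properties as ℕ
open import Data.Maybe using (Maybe; just; nothing)
open import Relation.Binary.PropositionalEquality as ≡ using (_≡_)
open import Algebra.Bundles using (CommutativeRing; RawRing)
import Algebra.Solver.Ring.AlmostCommutativeRing as ACR

m∸n+n≡m+[n∸m] : ∀ m n → (m ℕ.∸ n) ℕ.+ n ≡ m ℕ.+ (n ℕ.∸ m)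
m∸n+n≡m+[n∸m] ℕ.zero    ℕ.zero    = ≡.refl
m∸n+n≡m+[n∸m] ℕ.zero    (ℕ.suc n) = ≡.refl
m∸n+n≡m+[n∸m] (ℕ.suc m) ℕ.zero    = ≡.refl
m∸n+n≡m+[n∸m] (ℕ.suc m) (ℕ.suc n) =
  ≡.trans (ℕ.+-suc (m ℕ.∸ n) n) (≡.cong ℕ.suc (m∸n+n≡m+[n∸m] m n))

-- Coefficients are kept reduced (one side zero) so that the
-- normal forms of equal polynomials coincide definitionally and 'solve … refl' succeeds.
module RingSolver {c ℓ : Level} (R : CommutativeRing c ℓ) where
  open CommutativeRing R
  open import Algebra.Properties.Semiring.Mult semiring using (×-homo-+; ×1-homo-*; ×-congˡ)
    renaming (_×_ to _×ᵣ_)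
  open import Algebra.Properties.Ring ring using (-‿distribˡ-*; -‿distribʳ-*; -‿involutive; -0#≈0#)
  open import Algebra.Properties.AbelianGroup +-abelianGroup using (⁻¹-∙-comm)
  open import Algebra.Properties.CommutativeSemigroup +-commutativeSemigroup using (interchange)
  open import Relation.Binary.Reasoning.Setoid setoid

  private
    reduce : ℕ × ℕ → ℕ × ℕ
    reduce (m , n) = (m ℕ.∸ n , n ℕ.∸ m)

    Coefficients : RawRing _ _
    Coefficients = record
      { Carrier = ℕ × ℕ
      ; _≈_ = _≡_
      ; _+_ = λ { (a , b) (c , d) → reduce (a ℕ.+ c , b ℕ.+ d) }
      ; _*_ = λ { (a , b) (c , d) → reduce (a ℕ.* c ℕ.+ b ℕ.* d , a ℕ.* d ℕ.+ b ℕ.* c) }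
      ; -_ = λ { (a , b) → (b , a) }
      ; 0# = (0 , 0)
      ; 1# = (1 , 0)
      }

    ι : ℕ → Carrier
    ι n = n ×ᵣ 1#

    ⟦_⟧ᶜ : ℕ × ℕ → Carrier
    ⟦ (m , n) ⟧ᶜ = ι m - ι n

    -‿distrib-+ : ∀ x y → - (x + y) ≈ - x + - y
    -‿distrib-+ x y = sym (⁻¹-∙-comm x y)

    -‿interchange : ∀ a b c d → (a + c) - (b + d) ≈ (a - b) + (c - d)
    -‿interchange a b c d = trans (+-congˡ (-‿distrib-+ b d)) (interchange a c (- b) (- d))

    x+w≈z+y⇒x-y≈z-w : ∀ x y z w → x + w ≈ z + y → x - y ≈ z - w
    x+w≈z+y⇒x-y≈z-w x y z w e = begin
      x - y              ≈⟨ sym (+-identityʳ _) ⟩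
      (x - y) + 0#       ≈⟨ +-congˡ (sym (-‿inverseʳ w)) ⟩
      (x - y) + (w - w)  ≈⟨ interchange x (- y) w (- w) ⟩
      (x + w) + (- y - w) ≈⟨ +-cong e (+-comm _ _) ⟩
      (z + y) + (- w - y) ≈⟨ interchange z y (- w) (- y) ⟩
      (z - w) + (y - y)  ≈⟨ +-congˡ (-‿inverseʳ y) ⟩
      (z - w) + 0#       ≈⟨ +-identityʳ _ ⟩
      z - w              ∎

    ι-difference : ∀ a b c d → a ℕ.+ d ≡ c ℕ.+ b → ι a - ι b ≈ ι c - ι d
    ι-difference a b c d e = x+w≈z+y⇒x-y≈z-w _ _ _ _
      (trans (sym (×-homo-+ 1# a d)) (trans (×-congˡ e) (×-homo-+ 1# c b)))

    ⟦reduce⟧ : ∀ x → ⟦ reduce x ⟧ᶜ ≈ ⟦ x ⟧ᶜ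
    ⟦reduce⟧ (a , b) = ι-difference (a ℕ.∸ b) (b ℕ.∸ a) a b (m∸n+n≡m+[n∸m] a b)

    ⟦⟧-+ : ∀ x y → ⟦ RawRing._+_ Coefficients x y ⟧ᶜ ≈ ⟦ x ⟧ᶜ + ⟦ y ⟧ᶜ
    ⟦⟧-+ (a , b) (c , d) = begin
      ⟦ reduce (a ℕ.+ c , b ℕ.+ d) ⟧ᶜ ≈⟨ ⟦reduce⟧ (a ℕ.+ c , b ℕ.+ d) ⟩
      ι (a ℕ.+ c) - ι (b ℕ.+ d)          ≈⟨ +-cong (×-homo-+ 1# a c) (-‿cong (×-homo-+ 1# b d)) ⟩
      (ι a + ι c) - (ι b + ι d)          ≈⟨ -‿interchange _ _ _ _ ⟩
      (ι a - ι b) + (ι c - ι d)          ∎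

    ι-bilinear : ∀ a b c d → ι (a ℕ.* c ℕ.+ b ℕ.* d) ≈ ι a * ι c + ι b * ι d
    ι-bilinear a b c d = trans (×-homo-+ 1# (a ℕ.* c) (b ℕ.* d)) (+-cong (×1-homo-* a c) (×1-homo-* b d))

    -‿expand-* : ∀ A B C D → (A - B) * (C - D) ≈ (A * C + B * D) - (A * D + B * C)
    -‿expand-* A B C D = begin
      (A - B) * (C - D)                     ≈⟨ distribʳ (C - D) A (- B) ⟩
      A * (C - D) + (- B) * (C - D)         ≈⟨ +-cong (distribˡ A C (- D)) (distribˡ (- B) C (- D)) ⟩
      (A * C + A * - D) + (- B * C + - B * - D)
        ≈⟨ +-cong (+-congˡ (sym (-‿distribʳ-* A D)))
                  (+-cong (sym (-‿distribˡ-* B C))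
                          (trans (sym (-‿distribˡ-* B (- D)))
                                 (trans (-‿cong (sym (-‿distribʳ-* B D))) (-‿involutive (B * D))))) ⟩
      (A * C - A * D) + (- (B * C) + B * D) ≈⟨ +-congˡ (+-comm _ _) ⟩
      (A * C - A * D) + (B * D - B * C)     ≈⟨ sym (-‿interchange _ _ _ _) ⟩
      (A * C + B * D) - (A * D + B * C)     ∎

    ⟦⟧-* : ∀ x y → ⟦ RawRing._*_ Coefficients x y ⟧ᶜ ≈ ⟦ x ⟧ᶜ * ⟦ y ⟧ᶜ
    ⟦⟧-* (a , b) (c , d) = begin
      ⟦ reduce (a ℕ.* c ℕ.+ b ℕ.* d , a ℕ.* d ℕ.+ b ℕ.* c) ⟧ᶜ
        ≈⟨ ⟦reduce⟧ (a ℕ.* c ℕ.+ b ℕ.* d , a ℕ.* d ℕ.+ b ℕ.* c) ⟩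
      ι (a ℕ.* c ℕ.+ b ℕ.* d) - ι (a ℕ.* d ℕ.+ b ℕ.* c)
        ≈⟨ +-cong (ι-bilinear a b c d) (-‿cong (ι-bilinear a b d c)) ⟩
      (ι a * ι c + ι b * ι d) - (ι a * ι d + ι b * ι c)
        ≈⟨ sym (-‿expand-* _ _ _ _) ⟩
      (ι a - ι b) * (ι c - ι d) ∎

    ⟦⟧-neg : ∀ x → ⟦ RawRing.-_ Coefficients x ⟧ᶜ ≈ - ⟦ x ⟧ᶜ
    ⟦⟧-neg (a , b) = sym (begin
      - (ι a - ι b)     ≈⟨ -‿distrib-+ _ _ ⟩
      - ι a + - - ι b   ≈⟨ +-congˡ (-‿involutive _) ⟩
      - ι a + ι b       ≈⟨ +-comm _ _ ⟩
      ι b - ι a         ∎)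

    homomorphism : Coefficients ACR.-Raw-AlmostCommutative⟶ ACR.fromCommutativeRing R
    homomorphism = record
      { ⟦_⟧ = ⟦_⟧ᶜ
      ; +-homo = ⟦⟧-+
      ; *-homo = ⟦⟧-*
      ; -‿homo = ⟦⟧-neg
      ; 0-homo = trans (+-congˡ -0#≈0#) (+-identityʳ 0#)
      ; 1-homo = trans (+-congˡ -0#≈0#) (trans (+-identityʳ _) (+-identityʳ 1#))
      }

    ≟ᶜ : ∀ x y → Maybe (⟦ x ⟧ᶜ ≈ ⟦ y ⟧ᶜ)
    ≟ᶜ (a , b) (c , d) with a ℕ.+ d ℕ.≟ c ℕ.+ b
    ... | yes e = just (ι-difference a b c d e)
    ... | no _  = nothing

  open import Algebra.Solver.Ring Coefficients (ACR.fromCommutativeRing R) homomorphism ≟ᶜ public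

module Euclidean {c ℓ : Level} (R : CommutativeRing c ℓ) where
  open CommutativeRing R
  open RingSolver R using (solve; _:=_; _:+_; _:*_; _:-_)
  open import Algebra.Properties.Group +-group using (x≈y⇒x∙y⁻¹≈ε)
  open import Relation.Binary.Reasoning.Setoid setoid

  infixl 6 _⊖_
  infix  7 _·_

  Vector : Set c
  Vector = Carrier × Carrier

  _⊖_ : Vector → Vector → Vector
  (x₁ , x₂) ⊖ (y₁ , y₂) = (x₁ - y₁ , x₂ - y₂)

  _·_ : Vector → Vector → Carrier
  (x₁ , x₂) · (y₁ , y₂) = x₁ * y₁ + x₂ * y₂

  ∥_∥² : Vector → Carrier
  ∥ x ∥² = x · x

  double : Carrier → Carrier
  double x = x + x

  ∥⊖∥²-comm : ∀ P Q → ∥ P ⊖ Q ∥² ≈ ∥ Q ⊖ P ∥²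
  ∥⊖∥²-comm (p₁ , p₂) (q₁ , q₂) = solve 4
    (λ p₁ p₂ q₁ q₂ → (p₁ :- q₁) :* (p₁ :- q₁) :+ (p₂ :- q₂) :* (p₂ :- q₂)
                  := (q₁ :- p₁) :* (q₁ :- p₁) :+ (q₂ :- p₂) :* (q₂ :- p₂)) refl p₁ p₂ q₁ q₂

  polarization : ∀ P Q X → double ((P ⊖ X) · (Q ⊖ X)) ≈ ∥ P ⊖ X ∥² + ∥ Q ⊖ X ∥² - ∥ P ⊖ Q ∥²
  polarization (p₁ , p₂) (q₁ , q₂) (x₁ , x₂) = solve 6
    (λ p₁ p₂ q₁ q₂ x₁ x₂ →
      let pq = (p₁ :- x₁) :* (q₁ :- x₁) :+ (p₂ :- x₂) :* (q₂ :- x₂)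
          nrm a₁ a₂ = a₁ :* a₁ :+ a₂ :* a₂
      in pq :+ pq := nrm (p₁ :- x₁) (p₂ :- x₂) :+ nrm (q₁ :- x₁) (q₂ :- x₂) :- nrm (p₁ :- q₁) (p₂ :- q₂))
    refl p₁ p₂ q₁ q₂ x₁ x₂

  -- Stated times 4 with doubled inner products,
  -- the form in which they arise from polarization.
  gram-plane : ∀ p s w →
    ∥ w ∥² * (double ∥ p ∥² * double ∥ s ∥² - double (p · s) * double (p · s))
      ≈ ∥ s ∥² * (double (p · w) * double (p · w)) + ∥ p ∥² * (double (s · w) * double (s · w))
        - double (p · w) * double (s · w) * double (p · s)
  gram-plane (p₁ , p₂) (s₁ , s₂) (w₁ , w₂) = solve 6
    (λ p₁ p₂ s₁ s₂ w₁ w₂ →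
      let dot a₁ a₂ b₁ b₂ = a₁ :* b₁ :+ a₂ :* b₂
          dbl e = e :+ e
          pp = dot p₁ p₂ p₁ p₂ ; ss = dot s₁ s₂ s₁ s₂ ; ww = dot w₁ w₂ w₁ w₂
          ps = dbl (dot p₁ p₂ s₁ s₂) ; pw = dbl (dot p₁ p₂ w₁ w₂) ; sw = dbl (dot s₁ s₂ w₁ w₂)
      in ww :* (dbl pp :* dbl ss :- ps :* ps)
           := ss :* (pw :* pw) :+ pp :* (sw :* sw) :- pw :* sw :* ps) refl p₁ p₂ s₁ s₂ w₁ w₂

  chord : ∀ {M r P X} → ∥ P ⊖ M ∥² ≈ r * r → ∥ X ⊖ M ∥² ≈ r * r →
          double ((P ⊖ X) · (M ⊖ X)) ≈ ∥ P ⊖ X ∥²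
  chord {M} {P = P} {X} P∈ X∈ = begin
    double ((P ⊖ X) · (M ⊖ X))                ≈⟨ polarization P M X ⟩
    ∥ P ⊖ X ∥² + ∥ M ⊖ X ∥² - ∥ P ⊖ M ∥²       ≈⟨ +-assoc _ _ _ ⟩
    ∥ P ⊖ X ∥² + (∥ M ⊖ X ∥² - ∥ P ⊖ M ∥²)     ≈⟨ +-congˡ (x≈y⇒x∙y⁻¹≈ε MX≈PM) ⟩
    ∥ P ⊖ X ∥² + 0#                           ≈⟨ +-identityʳ _ ⟩
    ∥ P ⊖ X ∥²                                ∎
    where
    MX≈PM : ∥ M ⊖ X ∥² ≈ ∥ P ⊖ M ∥²
    MX≈PM = trans (∥⊖∥²-comm M X) (trans X∈ (sym P∈))

  circumradius : ∀ {M r A B X u v Q} →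
    ∥ A ⊖ M ∥² ≈ r * r → ∥ B ⊖ M ∥² ≈ r * r → ∥ X ⊖ M ∥² ≈ r * r →
    ∥ A ⊖ X ∥² ≈ u → ∥ B ⊖ X ∥² ≈ v → ∥ A ⊖ B ∥² ≈ Q →
    r * r * (double u * double v - (u + v - Q) * (u + v - Q)) ≈ u * v * Q
  circumradius {M} {r} {A} {B} {X} {u} {v} {Q} A∈ B∈ X∈ AX≈u BX≈v AB≈Q = begin
    r * r * (double u * double v - n * n)
      ≈⟨ *-cong (sym ww≈rr) (+-cong (*-cong (double-cong (sym AX≈u)) (double-cong (sym BX≈v)))
                                    (-‿cong (*-cong (sym ps≈n) (sym ps≈n)))) ⟩
    ∥ w ∥² * (double ∥ p ∥² * double ∥ s ∥² - double (p · s) * double (p · s))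
      ≈⟨ gram-plane p s w ⟩
    ∥ s ∥² * (double (p · w) * double (p · w)) + ∥ p ∥² * (double (s · w) * double (s · w))
      - double (p · w) * double (s · w) * double (p · s)
      ≈⟨ +-cong (+-cong (*-cong BX≈v (*-cong pw≈u pw≈u)) (*-cong AX≈u (*-cong sw≈v sw≈v)))
                (-‿cong (*-cong (*-cong pw≈u sw≈v) ps≈n)) ⟩
    v * (u * u) + u * (v * v) - u * v * n
      ≈⟨ solve 3 (λ u v Q → v :* (u :* u) :+ u :* (v :* v) :- u :* v :* (u :+ v :- Q)
                              := u :* v :* Q) refl u v Q ⟩
    u * v * Q ∎
    where
    p s w : Vector
    p = A ⊖ X
    s = B ⊖ X
    w = M ⊖ X
    n : Carrier
    n = u + v - Q
    double-cong : ∀ {x y} → x ≈ y → double x ≈ double y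
    double-cong e = +-cong e e
    ww≈rr : ∥ w ∥² ≈ r * r
    ww≈rr = trans (∥⊖∥²-comm M X) X∈
    pw≈u : double (p · w) ≈ u
    pw≈u = trans (chord A∈ X∈) AX≈u
    sw≈v : double (s · w) ≈ v
    sw≈v = trans (chord B∈ X∈) BX≈v
    ps≈n : double (p · s) ≈ n
    ps≈n = trans (polarization A B X) (+-cong (+-cong AX≈u BX≈v) (-‿cong AB≈Q))

  coordinate²-identity₁ : ∀ p₁ p₂ w₁ w₂ →
    double (p₁ * p₁ * ∥ (w₁ , w₂) ∥²)
      ≈ (p₁ * w₁ - p₂ * w₂) * double ((p₁ , p₂) · (w₁ , w₂)) + double (w₂ * w₂) * ∥ (p₁ , p₂) ∥²
  coordinate²-identity₁ = solve 4 (λ p₁ p₂ w₁ w₂ →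
    (p₁ :* p₁ :* (w₁ :* w₁ :+ w₂ :* w₂)) :+ (p₁ :* p₁ :* (w₁ :* w₁ :+ w₂ :* w₂))
      := (p₁ :* w₁ :- p₂ :* w₂) :* ((p₁ :* w₁ :+ p₂ :* w₂) :+ (p₁ :* w₁ :+ p₂ :* w₂))
         :+ (w₂ :* w₂ :+ w₂ :* w₂) :* (p₁ :* p₁ :+ p₂ :* p₂)) refl

  coordinate²-identity₂ : ∀ p₁ p₂ w₁ w₂ →
    double (p₂ * p₂ * ∥ (w₁ , w₂) ∥²)
      ≈ (p₂ * w₂ - p₁ * w₁) * double ((p₁ , p₂) · (w₁ , w₂)) + double (w₁ * w₁) * ∥ (p₁ , p₂) ∥²
  coordinate²-identity₂ = solve 4 (λ p₁ p₂ w₁ w₂ →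
    (p₂ :* p₂ :* (w₁ :* w₁ :+ w₂ :* w₂)) :+ (p₂ :* p₂ :* (w₁ :* w₁ :+ w₂ :* w₂))
      := (p₂ :* w₂ :- p₁ :* w₁) :* ((p₁ :* w₁ :+ p₂ :* w₂) :+ (p₁ :* w₁ :+ p₂ :* w₂))
         :+ (w₁ :* w₁ :+ w₁ :* w₁) :* (p₁ :* p₁ :+ p₂ :* p₂)) refl

module PlaneGeometry {c ℓ : Level} (F : Field c ℓ) where
  open Field F
  open FieldNotions F
  open Euclidean commRing
    using (_⊖_; _·_; ∥_∥²; double; ∥⊖∥²-comm; chord; circumradius; coordinate²-identity₁; coordinate²-identity₂)
  open RingSolver commRing using (solve; _:=_; _:+_; _:*_; _:-_)
  open import Algebra.Properties.Ring ring using (-‿distribˡ-*)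
  open import Algebra.Properties.Group +-group using (x∙y⁻¹≈ε⇒x≈y; x≈y⇒x∙y⁻¹≈ε)
  open import Relation.Binary.Reasoning.Setoid setoid

  *-/-cancel : ∀ {x y} → ¬ y ≈ 0# → x * y * y ⁻¹ ≈ x
  *-/-cancel {x} {y} y≉0 = trans (*-assoc x y (y ⁻¹)) (trans (*-congˡ (inverseʳ y y≉0)) (*-identityʳ x))

  *-≉0 : ∀ {x y} → ¬ x ≈ 0# → ¬ y ≈ 0# → ¬ x * y ≈ 0#
  *-≉0 {x} {y} x≉0 y≉0 xy≈0 = y≉0 (begin
    y              ≈⟨ sym (*-/-cancel x≉0) ⟩
    y * x * x ⁻¹   ≈⟨ *-congʳ (*-comm y x) ⟩
    x * y * x ⁻¹   ≈⟨ *-congʳ xy≈0 ⟩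
    0# * x ⁻¹      ≈⟨ zeroˡ _ ⟩
    0#             ∎)

  *-cancelʳ-≉0 : ∀ {x y z} → ¬ y ≈ 0# → x * y ≈ z * y → x ≈ z
  *-cancelʳ-≉0 {x} {y} {z} y≉0 e =
    trans (sym (*-/-cancel y≉0)) (trans (*-congʳ e) (*-/-cancel y≉0))

  2#*x≈double : ∀ x → 2# * x ≈ double x
  2#*x≈double x = trans (distribʳ x 1# 1#) (+-cong (*-identityˡ x) (*-identityˡ x))

  4#*x≈double-double : ∀ x → 4# * x ≈ double (double x)
  4#*x≈double-double x = trans (distribʳ x 2# 2#) (+-cong (2#*x≈double x) (2#*x≈double x))

  double-≉0 : CharNot2 → ∀ {x} → ¬ x ≈ 0# → ¬ double x ≈ 0#
  double-≉0 ch {x} x≉0 e = *-≉0 ch x≉0 (trans (2#*x≈double x) e)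

  4#≉0 : CharNot2 → ¬ 4# ≈ 0#
  4#≉0 ch = double-≉0 ch ch

  combination≈0 : ∀ {a b x y} → x ≈ 0# → y ≈ 0# → a * x + b * y ≈ 0#
  combination≈0 x≈0 y≈0 =
    trans (+-cong (trans (*-congˡ x≈0) (zeroʳ _)) (trans (*-congˡ y≈0) (zeroʳ _))) (+-identityʳ 0#)

  -- Over a field a nonzero vector may be isotropic, but not if it is also orthogonal to an
  -- anisotropic one. Only ¬¬ is available since ≈ is not decidable.
  isotropic-orthogonal⇒zero : CharNot2 → ∀ p w → ¬ ∥ w ∥² ≈ 0# → ∥ p ∥² ≈ 0# → double (p · w) ≈ 0# →
    ¬ ¬ (proj₁ p ≈ 0#) × ¬ ¬ (proj₂ p ≈ 0#)
  isotropic-orthogonal⇒zero ch (p₁ , p₂) (w₁ , w₂) w≉0 p≈0 pw≈0 =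
    (λ p₁≉0 → double-≉0 ch (*-≉0 (*-≉0 p₁≉0 p₁≉0) w≉0)
                (trans (coordinate²-identity₁ p₁ p₂ w₁ w₂) (combination≈0 pw≈0 p≈0))) ,
    (λ p₂≉0 → double-≉0 ch (*-≉0 (*-≉0 p₂≉0 p₂≉0) w≉0)
                (trans (coordinate²-identity₂ p₁ p₂ w₁ w₂) (combination≈0 pw≈0 p≈0)))

  distinct-on-circle⇒D²≉0 : CharNot2 → ∀ {M r P X} → ¬ r ≈ 0# → OnCircle M r P → OnCircle M r X →
    ¬ P ≈ₚ X → ¬ D² P X ≈ 0#
  distinct-on-circle⇒D²≉0 ch {M} {P = P} {X = X} r≉0 P∈ X∈ P≉X PX≈0 =
    proj₁ ¬¬p≈0 (λ p₁≈0 → proj₂ ¬¬p≈0 (λ p₂≈0 → P≉X (x∙y⁻¹≈ε⇒x≈y _ _ p₁≈0 , x∙y⁻¹≈ε⇒x≈y _ _ p₂≈0)))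
    where
    w≉0 : ¬ ∥ M ⊖ X ∥² ≈ 0#
    w≉0 e = *-≉0 r≉0 r≉0 (trans (sym (trans (∥⊖∥²-comm M X) X∈)) e)
    ¬¬p≈0 : ¬ ¬ (proj₁ (P ⊖ X) ≈ 0#) × ¬ ¬ (proj₂ (P ⊖ X) ≈ 0#)
    ¬¬p≈0 = isotropic-orthogonal⇒zero ch (P ⊖ X) (M ⊖ X) w≉0 PX≈0 (trans (chord P∈ X∈) PX≈0)

  1-/≈sq : ∀ {K D N q} → ¬ K ≈ 0# → ¬ D ≈ 0# → K * (sq D - sq N) ≈ sq D * q → 1# - q / K ≈ sq (N / D)
  1-/≈sq {K} {D} {N} {q} K≉0 D≉0 e = *-cancelʳ-≉0 (*-≉0 K≉0 (*-≉0 D≉0 D≉0)) (trans lhs (sym rhs))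
    where
    lhs : (1# - q / K) * (K * sq D) ≈ K * sq N
    lhs = begin
      (1# - q / K) * (K * sq D)
        ≈⟨ distribʳ _ 1# (- (q / K)) ⟩
      1# * (K * sq D) + - (q / K) * (K * sq D)
        ≈⟨ +-cong (*-identityˡ _) (sym (-‿distribˡ-* _ _)) ⟩
      K * sq D - q * K ⁻¹ * (K * sq D)
        ≈⟨ +-congˡ (-‿cong (solve 4 (λ q i K D → q :* i :* (K :* (D :* D)) := (D :* D :* q) :* K :* i)
                                     refl q (K ⁻¹) K D)) ⟩
      K * sq D - sq D * q * K * K ⁻¹
        ≈⟨ +-congˡ (-‿cong (*-/-cancel K≉0)) ⟩
      K * sq D - sq D * q
        ≈⟨ solve 4 (λ K D N q → K :* (D :* D) :- D :* D :* q
                                := K :* (D :* D :- N :* N) :- D :* D :* q :+ K :* (N :* N)) refl K D N q ⟩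
      K * (sq D - sq N) - sq D * q + K * sq N
        ≈⟨ +-congʳ (x≈y⇒x∙y⁻¹≈ε e) ⟩
      0# + K * sq N
        ≈⟨ +-identityˡ _ ⟩
      K * sq N ∎
    rhs : sq (N / D) * (K * sq D) ≈ K * sq N
    rhs = begin
      sq (N / D) * (K * sq D)
        ≈⟨ solve 4 (λ N i K D → (N :* i) :* (N :* i) :* (K :* (D :* D)) := K :* (N :* N) :* D :* i :* D :* i)
                   refl N (D ⁻¹) K D ⟩
      K * sq N * D * D ⁻¹ * D * D ⁻¹
        ≈⟨ *-/-cancel D≉0 ⟩
      K * sq N * D * D ⁻¹
        ≈⟨ *-/-cancel D≉0 ⟩
      K * sq N ∎

  law-of-sines² : ∀ {M r A B X a b c} → OnCircle M r A → OnCircle M r B → OnCircle M r X →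
    D² A X ≈ sq b → D² B X ≈ sq a → D² A B ≈ sq c →
    4# * sq r * (sq (double (a * b)) - sq (sq b + sq a - sq c)) ≈ sq (double (a * b)) * sq c
  law-of-sines² {r = r} {a = a} {b} {c} A∈ B∈ X∈ AX≈b² BX≈a² AB≈c² = begin
    4# * sq r * (sq (double (a * b)) - sq N)
      ≈⟨ solve 5 (λ f r a b N → f :* (r :* r) :* ((a :* b :+ a :* b) :* (a :* b :+ a :* b) :- N :* N)
                              := f :* (r :* r :* ((b :* b :+ b :* b) :* (a :* a :+ a :* a) :- N :* N)))
                 refl 4# r a b N ⟩
    4# * (sq r * (double (sq b) * double (sq a) - N * N))
      ≈⟨ *-congˡ (circumradius A∈ B∈ X∈ AX≈b² BX≈a² AB≈c²) ⟩
    4# * (sq b * sq a * sq c)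
      ≈⟨ 4#*x≈double-double _ ⟩
    double (double (sq b * sq a * sq c))
      ≈⟨ solve 3 (λ a b c → let bac = b :* b :* (a :* a) :* (c :* c) in (bac :+ bac) :+ (bac :+ bac)
                            := (a :* b :+ a :* b) :* (a :* b :+ a :* b) :* (c :* c)) refl a b c ⟩
    sq (double (a * b)) * sq c ∎
    where
    N : Carrier
    N = sq b + sq a - sq c

  InPrime-+ : ∀ {x y} → InPrime x → InPrime y → InPrime (x + y)
  InPrime-+ x∈ y∈ S S-subfield = IsSubfield.+-clos S-subfield (x∈ S S-subfield) (y∈ S S-subfield)

  InPrime-- : ∀ {x} → InPrime x → InPrime (- x)
  InPrime-- x∈ S S-subfield = IsSubfield.neg-clos S-subfield (x∈ S S-subfield)

  InPrime-* : ∀ {x y} → InPrime x → InPrime y → InPrime (x * y)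
  InPrime-* x∈ y∈ S S-subfield = IsSubfield.*-clos S-subfield (x∈ S S-subfield) (y∈ S S-subfield)

  InPrime-⁻¹ : ∀ {x} → ¬ x ≈ 0# → InPrime x → InPrime (x ⁻¹)
  InPrime-⁻¹ x≉0 x∈ S S-subfield = IsSubfield.⁻¹-clos S-subfield (x∈ S S-subfield) x≉0

mainTheorem4 : {c ℓ : Level} (F : Field c ℓ) →
    let open Field F in
    let open FieldNotions F in
    CharNot2 → (M : Point) → (r : Carrier) → ¬ (r ≈ 0#) → (q : Carrier) →
    PerfectDistance M r q →
    SquareInPrime q × SquareInPrime (1# - (q / (4# * sq r)))
mainTheorem4 F ch M r r≉0 q
  (A , B , X , A∈ , B∈ , X∈ , _ , A≉X , B≉X , (c , c∈P , AB≈c²) , (b , b∈P , AX≈b²) , (a , a∈P , BX≈a²) , q≈AB) =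
  (c , c∈P , q≈c²) , (N / D , N/D∈P , 1-/≈sq (*-≉0 (4#≉0 ch) (*-≉0 r≉0 r≉0)) D≉0 sines)
  where
  open Field F
  open FieldNotions F
  open PlaneGeometry F
  open Euclidean commRing using (double)

  q≈c² : q ≈ sq c
  q≈c² = trans q≈AB AB≈c²

  side≉0 : ∀ {P s} → OnCircle M r P → ¬ P ≈ₚ X → D² P X ≈ sq s → ¬ s ≈ 0#
  side≉0 P∈ P≉X PX≈s² s≈0 =
    distinct-on-circle⇒D²≉0 ch r≉0 P∈ X∈ P≉X (trans PX≈s² (trans (*-congʳ s≈0) (zeroˡ _)))

  N D : Carrier
  N = sq b + sq a - sq c
  D = double (a * b)

  D≉0 : ¬ D ≈ 0#
  D≉0 = double-≉0 ch (*-≉0 (side≉0 B∈ B≉X BX≈a²) (side≉0 A∈ A≉X AX≈b²))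

  N/D∈P : InPrime (N / D)
  N/D∈P = InPrime-* (InPrime-+ (InPrime-+ (InPrime-* b∈P b∈P) (InPrime-* a∈P a∈P))
                               (InPrime-- (InPrime-* c∈P c∈P)))
                    (InPrime-⁻¹ D≉0 (InPrime-+ (InPrime-* a∈P b∈P) (InPrime-* a∈P b∈P)))

  sines : 4# * sq r * (sq D - sq N) ≈ sq D * q
  sines = trans (law-of-sines² A∈ B∈ X∈ AX≈b² BX≈a² AB≈c²) (*-congˡ (sym q≈c²))
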